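{- $b(1,1;2)=6$.
   Context: A family of sets is a set $F$ of sets. A set $X$ with $|X|\le t$ is a $t$-transversal of $F$ if it meets every member of $F$. $F$ has the $t$-property if for every $A\in F$ the family $F\setminus\{A\}$ has a $t$-transversal $X$ with $X\cap A=\emptyset$. $b(1,1;t)$ is the supremum of $|F|$ over all families $F$ with $|A\cap B|\le1$ for all distinct $A,B\in F$ and with the $t$-property. -}

module Defs where

open import Data.Nat using (ℕ; _≤_)
open import Data.Fin using (Fin)
open import Data.List using (List; length)
open import Data.List.Relation.Unary.Any using (Any)
open import Data.List.Relation.Unary.All using (All)
open import Data.Product using (Σ; _×_)
open import Relation.Nullary using (¬_)
open import Relation.Binary.PropositionalEquality using (_≡_; _≢_)
open import Function.Definitions using (Injective)

-- A family of sets over a ground type U is given by an index type I and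
-- members A i (subsets of U, as predicates).  The family F = { A i | i : I }.

-- Distinct indices give distinct (extensionally different) sets, so the
-- indexing is a bijection onto the family F.
DistinctMembers : {U I : Set} → (I → U → Set) → Set
DistinctMembers {U} {I} A =
  ∀ (i j : I) → i ≢ j → ¬ (∀ (x : U) → (A i x → A j x) × (A j x → A i x))

IntersectAtMostOne : {U I : Set} → (I → U → Set) → Set
IntersectAtMostOne {U} {I} A =
  ∀ (i j : I) → i ≢ j → ∀ (x y : U) → A i x → A j x → A i y → A j y → x ≡ y

TransversalAvoiding : {U I : Set} → ℕ → (I → U → Set) → I → List U → Set
TransversalAvoiding {U} {I} t A i X =
  length X ≤ t × All (λ x → ¬ A i x) X × (∀ (j : I) → j ≢ i → Any (A j) X)

HasTProperty : {U I : Set} → ℕ → (I → U → Set) → Set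
HasTProperty {U} {I} t A = ∀ (i : I) → Σ (List U) (TransversalAvoiding t A i)

AtMostMembers : Set → ℕ → Set
AtMostMembers I n = ∀ (f : Fin (Data.Nat.suc n) → I) → ¬ Injective _≡_ _≡_ f

-- Admissible families for b(1,1;t).
Admissible : {U I : Set} → ℕ → (I → U → Set) → Set
Admissible t A = DistinctMembers A × IntersectAtMostOne A × HasTProperty t A

-- Let A be a family whose distinct members meet in at most one
-- point and which has the 2-property, so every member i comes with two
-- points outside A i such that every other member contains one of them (a
-- "point pair" of i).  By pigeonhole, two of any three other members share a
-- point of that pair.  This gives, in turn:
--   * every point lies in at most three members (atMostThree);
--   * a point x in three members i, j, k and a point y in three further
--     members cannot coexist (threeAndThree): the pair of i is split by j and
--     k, and two of the members through y share a point of it, which is y;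
--     so y lies in j or k as well, i.e. in four members.
-- Given seven distinct members, the point pair of the first sorts the other
-- six by the point they contain; both parts have at most three elements,
-- hence exactly three, which is impossible (noSevenMembers).
--
-- The six edges of the complete graph K₄, as 2-subsets of a
-- 4-set, meet pairwise in at most one vertex, and the edge disjoint from a
-- given edge meets all the others; this finite example is checked by
-- evaluating decision procedures.

module Submission where

open import Defs
open import Data.Empty using (⊥; ⊥-elim)
open import Data.Fin using (Fin; #_; opposite; _≟_)
open import Data.Fin.Properties using (all?)
open import Data.List using (List; []; _∷_; length; tabulate)
open import Data.List.Membership.Propositional using (_∈_)
open import Data.List.Membership.DecPropositional (_≟_ {4}) using (_∈?_)
open import Data.List.Relation.Binary.Disjoint.Propositional using (Disjoint)
open import Data.List.Relation.Ternary.Interleaving using (Interleaving; []; _∷ˡ_; _∷ʳ_)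
open import Data.List.Relation.Ternary.Interleaving.Properties using (interleave-length)
open import Data.List.Relation.Unary.All as All using (All; []; _∷_)
open import Data.List.Relation.Unary.All.Properties using (All¬⇒¬Any)
open import Data.List.Relation.Unary.Any as Any using (Any; here; there)
open import Data.List.Relation.Unary.Any.Properties using (singleton⁻)
open import Data.List.Relation.Unary.AllPairs using ([]; _∷_)
open import Data.List.Relation.Unary.Unique.Propositional using (Unique)
open import Data.List.Relation.Unary.Unique.Propositional.Properties using (tabulate⁺)
open import Data.Nat using (_+_; _≤_; _≤?_; z≤n; s≤s)
open import Data.Nat.Properties using (+-monoʳ-≤; +-cancelʳ-≤; +-comm; suc-injective)
open import Data.Product using (Σ; ∃₂; _×_; _,_; proj₁; proj₂)
open import Data.Sum using (_⊎_; inj₁; inj₂)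
open import Data.Vec using (lookup) renaming (_∷_ to _∷ᵥ_; [] to []ᵥ)
open import Function using (case_of_)
open import Relation.Nullary using (¬_)
open import Relation.Nullary.Decidable using (from-yes; _×-dec_; _→-dec_; ¬?)
open import Relation.Binary.PropositionalEquality
  using (_≡_; _≢_; refl; sym; trans; subst; ≢-sym)

twoOfThree : {U : Set} {S P Q R : U → Set} {x y : U} → S x → S y →
             P x ⊎ P y → Q x ⊎ Q y → R x ⊎ R y →
             Σ U (λ z → S z × ((P z × Q z) ⊎ (P z × R z) ⊎ (Q z × R z)))
twoOfThree sx sy (inj₁ p) (inj₁ q) _        = _ , sx , inj₁ (p , q)
twoOfThree sx sy (inj₂ p) (inj₂ q) _        = _ , sy , inj₁ (p , q)
twoOfThree sx sy (inj₁ p) (inj₂ q) (inj₁ r) = _ , sx , inj₂ (inj₁ (p , r))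
twoOfThree sx sy (inj₁ p) (inj₂ q) (inj₂ r) = _ , sy , inj₂ (inj₂ (q , r))
twoOfThree sx sy (inj₂ p) (inj₁ q) (inj₁ r) = _ , sx , inj₂ (inj₂ (q , r))
twoOfThree sx sy (inj₂ p) (inj₁ q) (inj₂ r) = _ , sy , inj₂ (inj₁ (p , r))

sortBy : {I : Set} {P Q : I → Set} {L : List I} → All (λ j → P j ⊎ Q j) L →
         ∃₂ λ l r → Interleaving _≡_ _≡_ l r L × All P l × All Q r
sortBy [] = [] , [] , [] , [] , []
sortBy (inj₁ p ∷ choices) with l , r , sp , ps , qs ← sortBy choices =
  _ ∷ l , r , refl ∷ˡ sp , p ∷ ps , qs
sortBy (inj₂ q ∷ choices) with l , r , sp , ps , qs ← sortBy choices =
  l , _ ∷ r , refl ∷ʳ sp , ps , q ∷ qs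

allParts : {I : Set} {P : I → Set} {l r L : List I} →
           Interleaving _≡_ _≡_ l r L → All P L → All P l × All P r
allParts [] [] = [] , []
allParts (refl ∷ˡ sp) (p ∷ ps) with pl , pr ← allParts sp ps = p ∷ pl , pr
allParts (refl ∷ʳ sp) (p ∷ ps) with pl , pr ← allParts sp ps = pl , p ∷ pr

uniqueParts : {I : Set} {l r L : List I} → Interleaving _≡_ _≡_ l r L → Unique L →
              Unique l × Unique r × Disjoint l r
uniqueParts [] [] = [] , [] , λ ()
uniqueParts (refl ∷ˡ sp) (x≢L ∷ uL) with ul , ur , d ← uniqueParts sp uL
                                      | x≢l , x≢r ← allParts sp x≢L =
  x≢l ∷ ul , ur , λ { (here refl , x∈r) → All¬⇒¬Any x≢r x∈r
                    ; (there v∈l , v∈r) → d (v∈l , v∈r) }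
uniqueParts (refl ∷ʳ sp) (x≢L ∷ uL) with ul , ur , d ← uniqueParts sp uL
                                      | x≢l , x≢r ← allParts sp x≢L =
  ul , x≢r ∷ ur , λ { (v∈l , here refl) → All¬⇒¬Any x≢l v∈l
                    ; (v∈l , there v∈r) → d (v∈l , v∈r) }

apart : {I : Set} {l r : List I} {u w : I} → Disjoint l r → u ∈ l → w ∈ r → u ≢ w
apart d u∈l w∈r refl = d (u∈l , w∈r)

atLeastThree : ∀ m n → m + n ≡ 6 → n ≤ 3 → 3 ≤ m
atLeastThree m n m+n≡6 n≤3 = +-cancelʳ-≤ 3 3 m (subst (_≤ m + 3) m+n≡6 (+-monoʳ-≤ m n≤3))

record PointPair {U I : Set} (A : I → U → Set) (i : I) : Set where
  field
    fst snd : U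
    fst∉ : ¬ A i fst
    snd∉ : ¬ A i snd
    meets : ∀ j → j ≢ i → A j fst ⊎ A j snd

-- The t-property with t = 2 yields a point pair for each member i, provided
-- some other member j exists (so the transversal is not empty).
pointPair : {U I : Set} {A : I → U → Set} → HasTProperty 2 A →
            (i j : I) → j ≢ i → PointPair A i
pointPair {A = A} tp i j j≢i with X , size , outside , hits ← tp i =
  fromList X size outside hits (hits j j≢i)
  where
  fromList : ∀ X → length X ≤ 2 → All (λ x → ¬ A i x) X →
             (∀ k → k ≢ i → Any (A k) X) → Any (A j) X → PointPair A i
  fromList [] _ _ _ ()
  fromList (x ∷ []) _ (x∉ ∷ []) hits _ = record
    { fst = x ; snd = x ; fst∉ = x∉ ; snd∉ = x∉
    ; meets = λ k k≢i → inj₁ (singleton⁻ (hits k k≢i)) }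
  fromList (x ∷ y ∷ []) _ (x∉ ∷ y∉ ∷ []) hits _ = record
    { fst = x ; snd = y ; fst∉ = x∉ ; snd∉ = y∉
    ; meets = λ k k≢i → pair⁻ (hits k k≢i) }
    where
    pair⁻ : ∀ {P : _ → Set} → Any P (x ∷ y ∷ []) → P x ⊎ P y
    pair⁻ (here p)         = inj₁ p
    pair⁻ (there (here p)) = inj₂ p
  fromList (_ ∷ _ ∷ _ ∷ _) (s≤s (s≤s ())) _ _ _

module UpperBound {U I : Set} {A : I → U → Set}
                  (atMostOne : IntersectAtMostOne A) (tp : HasTProperty 2 A) where

  coincide : ∀ {j k p z} → j ≢ k → A j p → A k p → A j z → A k z → z ≡ p
  coincide j≢k jp kp jz kz = atMostOne _ _ j≢k _ _ jz kz jp kp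

  -- If p lies in distinct members a, b, c, d then the point pair of a has a
  -- point z ∉ A a lying in two of b, c, d; so z = p ∈ A a, a contradiction.
  noFourThroughPoint : ∀ {a b c d p} → a ≢ b → a ≢ c → a ≢ d → b ≢ c → b ≢ d → c ≢ d →
                       A a p → A b p → A c p → A d p → ⊥
  noFourThroughPoint {a} {b} {c} {d} {p} a≢b a≢c a≢d b≢c b≢d c≢d ap bp cp dp =
    case twoOfThree {S = λ z → ¬ A a z} {A b} {A c} {A d} fst∉ snd∉
           (meets b (≢-sym a≢b)) (meets c (≢-sym a≢c)) (meets d (≢-sym a≢d)) of λ
      { (z , z∉a , inj₁ (bz , cz))        → z∉a (inA b≢c bp cp bz cz)
      ; (z , z∉a , inj₂ (inj₁ (bz , dz))) → z∉a (inA b≢d bp dp bz dz)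
      ; (z , z∉a , inj₂ (inj₂ (cz , dz))) → z∉a (inA c≢d cp dp cz dz) }
    where
    open PointPair (pointPair tp a b (≢-sym a≢b))
    inA : ∀ {m n z} → m ≢ n → A m p → A n p → A m z → A n z → A a z
    inA m≢n mp np mz nz = subst (A a) (sym (coincide m≢n mp np mz nz)) ap

  atMostThree : ∀ {p} (M : List I) → Unique M → All (λ j → A j p) M → length M ≤ 3
  atMostThree [] _ _ = z≤n
  atMostThree (_ ∷ []) _ _ = s≤s z≤n
  atMostThree (_ ∷ _ ∷ []) _ _ = s≤s (s≤s z≤n)
  atMostThree (_ ∷ _ ∷ _ ∷ []) _ _ = s≤s (s≤s (s≤s z≤n))
  atMostThree (a ∷ b ∷ c ∷ d ∷ _)
              ((a≢b ∷ a≢c ∷ a≢d ∷ _) ∷ (b≢c ∷ b≢d ∷ _) ∷ (c≢d ∷ _) ∷ _)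
              (ap ∷ bp ∷ cp ∷ dp ∷ _) =
    ⊥-elim (noFourThroughPoint a≢b a≢c a≢d b≢c b≢d c≢d ap bp cp dp)

  -- If x lies in distinct members i, j, k, the two points of any point pair
  -- of i each lie in j or k: a point of the pair lying in both j and k
  -- would coincide with x ∈ A i.
  separated : ∀ {i j k x} → i ≢ j → i ≢ k → j ≢ k → A i x → A j x → A k x →
              (T : PointPair A i) → let open PointPair T in
              (A j fst ⊎ A k fst) × (A j snd ⊎ A k snd)
  separated {i} {j} {k} i≢j i≢k j≢k ix jx kx T =
    case meets j (≢-sym i≢j) , meets k (≢-sym i≢k) of λ
      { (inj₁ ju , inj₁ ku) → ⊥-elim (fst∉ (inA ju ku))
      ; (inj₁ ju , inj₂ kv) → inj₁ ju , inj₂ kv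
      ; (inj₂ jv , inj₁ ku) → inj₂ ku , inj₁ jv
      ; (inj₂ jv , inj₂ kv) → ⊥-elim (snd∉ (inA jv kv)) }
    where
    open PointPair T
    inA : ∀ {z} → A j z → A k z → A i z
    inA jz kz = subst (A i) (sym (coincide j≢k jx kx jz kz)) ix

  -- If x lies in distinct members i, j, k and y in distinct members e, f, g
  -- other than i, then y also lies in j or k: by pigeonhole two of e, f, g
  -- share a point of the point pair of i, which must be y, and both points
  -- of that pair lie in j or k.
  caught : ∀ {i j k e f g x y} → i ≢ j → i ≢ k → j ≢ k → e ≢ i → f ≢ i → g ≢ i →
           e ≢ f → e ≢ g → f ≢ g → A i x → A j x → A k x → A e y → A f y → A g y →
           A j y ⊎ A k y
  caught {i} {j} {k} {e} {f} {g} {y = y} i≢j i≢k j≢k e≢i f≢i g≢i e≢f e≢g f≢g ix jx kx ey fy gy =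
    case twoOfThree {S = λ z → A j z ⊎ A k z} {A e} {A f} {A g} fst∈jk snd∈jk
           (meets e e≢i) (meets f f≢i) (meets g g≢i) of λ
      { (z , z∈jk , inj₁ (ez , fz))        → isY e≢f ey fy ez fz z∈jk
      ; (z , z∈jk , inj₂ (inj₁ (ez , gz))) → isY e≢g ey gy ez gz z∈jk
      ; (z , z∈jk , inj₂ (inj₂ (fz , gz))) → isY f≢g fy gy fz gz z∈jk }
    where
    T : PointPair A i
    T = pointPair tp i j (≢-sym i≢j)
    open PointPair T
    fst∈jk : A j fst ⊎ A k fst
    fst∈jk = proj₁ (separated i≢j i≢k j≢k ix jx kx T)
    snd∈jk : A j snd ⊎ A k snd
    snd∈jk = proj₂ (separated i≢j i≢k j≢k ix jx kx T)
    isY : ∀ {m n z} → m ≢ n → A m y → A n y → A m z → A n z → A j z ⊎ A k z → A j y ⊎ A k y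
    isY m≢n my ny mz nz = subst (λ w → A j w ⊎ A k w) (coincide m≢n my ny mz nz)

  -- A point x in three members and a point y in three further members cannot
  -- coexist: y would lie in one of the first three as well (caught), hence
  -- in four members.
  threeAndThree : ∀ {x y} (l r : List I) → Unique l → Unique r → Disjoint l r →
                  All (λ j → A j x) l → All (λ j → A j y) r → 3 ≤ length l → 3 ≤ length r → ⊥
  threeAndThree [] _ _ _ _ _ _ () _
  threeAndThree (_ ∷ []) _ _ _ _ _ _ (s≤s ()) _
  threeAndThree (_ ∷ _ ∷ []) _ _ _ _ _ _ (s≤s (s≤s ())) _
  threeAndThree (_ ∷ _ ∷ _ ∷ _) [] _ _ _ _ _ _ ()
  threeAndThree (_ ∷ _ ∷ _ ∷ _) (_ ∷ []) _ _ _ _ _ _ (s≤s ())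
  threeAndThree (_ ∷ _ ∷ _ ∷ _) (_ ∷ _ ∷ []) _ _ _ _ _ _ (s≤s (s≤s ()))
  threeAndThree {y = y} l@(i ∷ j ∷ k ∷ _) r@(e ∷ f ∷ g ∷ _)
                ((i≢j ∷ i≢k ∷ _) ∷ (j≢k ∷ _) ∷ _) ur@((e≢f ∷ e≢g ∷ _) ∷ (f≢g ∷ _) ∷ _) l∩r
                (ix ∷ jx ∷ kx ∷ _) ys@(ey ∷ fy ∷ gy ∷ _) _ _ =
    case caught i≢j i≢k j≢k (≢i (here refl)) (≢i (there (here refl))) (≢i (there (there (here refl))))
                e≢f e≢g f≢g ix jx kx ey fy gy of λ
      { (inj₁ jy) → fourth (there (here refl)) jy
      ; (inj₂ ky) → fourth (there (there (here refl))) ky }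
    where
    ≢i : ∀ {w} → w ∈ r → w ≢ i
    ≢i w∈r = ≢-sym (apart l∩r (here refl) w∈r)
    fourth : ∀ {m} → m ∈ l → A m y → ⊥
    fourth m∈l my with atMostThree (_ ∷ r) (All.tabulate (apart l∩r m∈l) ∷ ur) (my ∷ ys)
    ... | s≤s (s≤s (s≤s ()))

  -- The point pair of the first one
  -- sorts the other six into those containing its first point and those
  -- containing its second; each part has at most three members, hence
  -- exactly three, which threeAndThree rules out.
  noSevenMembers : (M : List I) → Unique M → length M ≡ 7 → ⊥
  noSevenMembers [] _ ()
  noSevenMembers (_ ∷ []) _ ()
  noSevenMembers (a ∷ b ∷ L) (a≢bL ∷ ubL) len = fromSorting (sortBy sides)
    where
    open PointPair (pointPair tp a b (≢-sym (All.head a≢bL)))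
    sides : All (λ j → A j fst ⊎ A j snd) (b ∷ L)
    sides = All.map (λ a≢j → meets _ (≢-sym a≢j)) a≢bL
    fromSorting : (∃₂ λ l r → Interleaving _≡_ _≡_ l r (b ∷ L) ×
                              All (λ j → A j fst) l × All (λ j → A j snd) r) → ⊥
    fromSorting (l , r , sp , xl , yr) with ul , ur , l∩r ← uniqueParts sp ubL =
      threeAndThree l r ul ur l∩r xl yr
        (atLeastThree (length l) (length r) six (atMostThree r ur yr))
        (atLeastThree (length r) (length l) (trans (+-comm (length r) (length l)) six)
                      (atMostThree l ul xl))
      where
      six : length l + length r ≡ 6
      six = trans (sym (interleave-length sp)) (suc-injective len)

-- The six edges of the complete graph on four vertices, listed so that
-- the edge disjoint from edge i is edge (opposite i).
edge : Fin 6 → List (Fin 4)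
edge = lookup ((# 0 ∷ # 1 ∷ []) ∷ᵥ (# 0 ∷ # 2 ∷ []) ∷ᵥ (# 0 ∷ # 3 ∷ []) ∷ᵥ
               (# 1 ∷ # 2 ∷ []) ∷ᵥ (# 1 ∷ # 3 ∷ []) ∷ᵥ (# 2 ∷ # 3 ∷ []) ∷ᵥ []ᵥ)

K₄ : Fin 6 → Fin 4 → Set
K₄ i v = v ∈ edge i

K₄-distinct : DistinctMembers K₄
K₄-distinct = from-yes (all? λ i → all? λ j → ¬? (i ≟ j) →-dec ¬? (all? λ v →
  ((v ∈? edge i) →-dec (v ∈? edge j)) ×-dec ((v ∈? edge j) →-dec (v ∈? edge i))))

K₄-intersect : IntersectAtMostOne K₄
K₄-intersect = from-yes (all? λ i → all? λ j → ¬? (i ≟ j) →-dec all? λ v → all? λ w →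
  (v ∈? edge i) →-dec ((v ∈? edge j) →-dec ((w ∈? edge i) →-dec ((w ∈? edge j) →-dec (v ≟ w)))))

K₄-transversal : ∀ i → TransversalAvoiding 2 K₄ i (edge (opposite i))
K₄-transversal = from-yes (all? λ i → (length (edge (opposite i)) ≤? 2) ×-dec
  (All.all? (λ v → ¬? (v ∈? edge i)) (edge (opposite i)) ×-dec
   all? λ j → ¬? (j ≟ i) →-dec Any.any? (_∈? edge j) (edge (opposite i))))

K₄-admissible : Admissible 2 K₄
K₄-admissible = K₄-distinct , K₄-intersect , λ i → edge (opposite i) , K₄-transversal i

atMostSix : ∀ (U I : Set) (A : I → U → Set) → Admissible 2 A → AtMostMembers I 6
atMostSix U I A (_ , atMostOne , tp) f f-injective =
  UpperBound.noSevenMembers atMostOne tp (tabulate f) (tabulate⁺ f-injective) refl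

lemma11 : (∀ (U I : Set) (A : I → U → Set) → Admissible 2 A → AtMostMembers I 6)
          × Σ Set (λ U → Σ (Fin 6 → U → Set) (λ A → Admissible 2 A))
lemma11 = atMostSix , Fin 4 , K₄ , K₄-admissible
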